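{- Let $n$ be a positive integer which is a sum of three squares of integers. Then there exist integers $a,b,c$ such that $n=a^2+b^2+c^2$ and $\gcd(a,b,c,3)=1$. In particular, if $n$ is divisible by $3$, then $n$ is a sum of three squares of integers none of which is divisible by $3$. -}

module Defs where

open import Data.Integer using (ℤ; _+_; _*_)
open import Data.Product using (∃; _×_; _,_)
open import Relation.Binary.PropositionalEquality using (_≡_)

SumOfThreeSquares : ℤ → Set
SumOfThreeSquares n = ∃ λ a → ∃ λ b → ∃ λ c → n ≡ a * a + b * b + c * c

{-# OPTIONS --safe #-}
module Submission where

-- If 3 divides a, b and c, then n = 9m where m is again a sum of three squares, so by
-- descent it suffices to lift a representation m = x² + y² + z² with x, y, z not all
-- divisible by 3 to one of 9m with no coordinate divisible by 3. After changing the signs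
-- of two coordinates if necessary, s = x + y + z is prime to 3; reflecting (3x, 3y, 3z) in
-- the plane orthogonal to (1, 1, 1) gives (s − 3(y + z), s − 3(z + x), s − 3(x + y)), of
-- the same length and with every coordinate ≡ s mod 3. For the second claim: squares are
-- 0 or 1 mod 3, so if 3 divides a sum of three squares, either all or none of the roots
-- are divisible by 3.

open import Defs
open import Data.Nat using (ℕ)
open import Data.Product using (∃; _×_; _,_)
open import Data.Sum using (_⊎_; inj₁; inj₂)
open import Function using (_∘_)
open import Relation.Binary.PropositionalEquality
  using (_≡_; _≢_; refl; sym; trans; cong; cong₂; subst; ≢-sym; module ≡-Reasoning)
open import Relation.Nullary using (¬_; Dec; yes; no; contradiction)
open import Relation.Nullary.Decidable using (from-yes; _×-dec_; _⊎-dec_; _→-dec_; ¬?)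

module SquaresModulo3 where
  open import Data.Nat.Base using (_+_; _*_; _%_; _<_; NonZero)
  open import Data.Nat.Properties using (allUpTo?)
  open import Data.Nat.DivMod using (%-distribˡ-+; %-distribˡ-*; m%n<n)
  open import Data.Nat.Divisibility
    using (_∣_; _∤_; _∣?_; ∣-refl; m%n≡0⇒n∣m; n∣m⇒m%n≡0; %-presˡ-∣; ∣n∣m%n⇒∣m)
  import Data.Sum as Sum

  AllOrNone3∣ : ℕ → ℕ → ℕ → Set
  AllOrNone3∣ u v w = (3 ∣ u × 3 ∣ v × 3 ∣ w) ⊎ (3 ∤ u × 3 ∤ v × 3 ∤ w)

  SquareSumDichotomy : ℕ → ℕ → ℕ → Set
  SquareSumDichotomy u v w = 3 ∣ u * u + v * v + w * w → AllOrNone3∣ u v w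

  square-sum-dichotomy? : ∀ u v w → Dec (SquareSumDichotomy u v w)
  square-sum-dichotomy? u v w = 3 ∣? u * u + v * v + w * w →-dec
    ((3 ∣? u ×-dec 3 ∣? v ×-dec 3 ∣? w) ⊎-dec (¬? (3 ∣? u) ×-dec ¬? (3 ∣? v) ×-dec ¬? (3 ∣? w)))

  residue-dichotomy : ∀ {r} → r < 3 → ∀ {s} → s < 3 → ∀ {t} → t < 3 → SquareSumDichotomy r s t
  residue-dichotomy =
    from-yes (allUpTo? (λ r → allUpTo? (λ s → allUpTo? (square-sum-dichotomy? r s) 3) 3) 3)

  %-cong-+ : ∀ {a a′ b b′} d .{{_ : NonZero d}} →
             a % d ≡ a′ % d → b % d ≡ b′ % d → (a + b) % d ≡ (a′ + b′) % d
  %-cong-+ {a} {a′} {b} {b′} d a≡a′ b≡b′ = begin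
    (a + b) % d            ≡⟨ %-distribˡ-+ a b d ⟩
    (a % d + b % d) % d    ≡⟨ cong₂ (λ x y → (x + y) % d) a≡a′ b≡b′ ⟩
    (a′ % d + b′ % d) % d  ≡⟨ %-distribˡ-+ a′ b′ d ⟨
    (a′ + b′) % d          ∎
    where open ≡-Reasoning

  square-sum-% : ∀ d .{{_ : NonZero d}} u v w →
    (u * u + v * v + w * w) % d ≡ (u % d * (u % d) + v % d * (v % d) + w % d * (w % d)) % d
  square-sum-% d u v w =
    %-cong-+ d (%-cong-+ d (%-distribˡ-* u u d) (%-distribˡ-* v v d)) (%-distribˡ-* w w d)

  dichotomy-from-residues : ∀ u v w →
    SquareSumDichotomy (u % 3) (v % 3) (w % 3) → SquareSumDichotomy u v w
  dichotomy-from-residues u v w dichotomy 3∣sum =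
    Sum.map (λ (a , b , c) → ∣-from-residue a , ∣-from-residue b , ∣-from-residue c)
            (λ (a , b , c) → ∤-from-residue a , ∤-from-residue b , ∤-from-residue c)
            (dichotomy 3∣residue-sum)
    where
    3∣residue-sum : 3 ∣ u % 3 * (u % 3) + v % 3 * (v % 3) + w % 3 * (w % 3)
    3∣residue-sum = m%n≡0⇒n∣m _ 3 (trans (sym (square-sum-% 3 u v w)) (n∣m⇒m%n≡0 _ 3 3∣sum))
    ∣-from-residue : ∀ {x} → 3 ∣ x % 3 → 3 ∣ x
    ∣-from-residue = ∣n∣m%n⇒∣m ∣-refl
    ∤-from-residue : ∀ {x} → 3 ∤ x % 3 → 3 ∤ x
    ∤-from-residue 3∤r 3∣x = 3∤r (%-presˡ-∣ 3∣x ∣-refl)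

  square-sum-dichotomy : ∀ u v w → SquareSumDichotomy u v w
  square-sum-dichotomy u v w = dichotomy-from-residues u v w
    (residue-dichotomy (m%n<n u 3) (m%n<n v 3) (m%n<n w 3))

open SquaresModulo3 using (square-sum-dichotomy)

open import Data.Integer using (ℤ; +_; _+_; _*_; _>_; 1ℤ; 0ℤ; -_; _-_; ∣_∣; sign; _◃_)
open import Data.Integer.Properties using (abs-*; ∣i∣≡0⇒i≡0; +◃n≡+n; pos-+; <⇒≢)
open import Data.Integer.GCD using (gcd; gcd[i,j]∣i; gcd[i,j]∣j)
open import Data.Integer.Divisibility using (_∣_)
open import Data.Integer.Divisibility.Signed
  using (divides; ∣ᵤ⇒∣; ∣⇒∣ᵤ; ∣-refl; ∣m∣n⇒∣m+n; ∣m+n∣n⇒∣m; ∣m⇒∣-m; ∣m⇒∣m*n)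
open import Data.Integer.Tactic.RingSolver using (solve-∀)
open import Data.Sign.Properties using (s*s≡+)
import Data.Nat.Base as ℕ
import Data.Nat.Properties as ℕ
import Data.Nat.Divisibility as ℕ
import Data.Nat.GCD as ℕ
open import Data.Nat.Coprimality using (coprime-divisor; prime⇒coprime)
open import Data.Nat.Primality using (Prime; prime?; prime⇒irreducible)
open import Data.Nat.Induction using (<-wellFounded)
open import Induction.WellFounded using (Acc; acc)

prime[3] : Prime 3
prime[3] = from-yes (prime? 3)

prime∤⇒gcd≡1 : ∀ {p m} → Prime p → ¬ p ℕ.∣ m → ℕ.gcd m p ≡ 1
prime∤⇒gcd≡1 {p} {m} prime-p p∤m with prime⇒irreducible prime-p (ℕ.gcd[m,n]∣n m p)
... | inj₁ gcd≡1 = gcd≡1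
... | inj₂ gcd≡p = contradiction (subst (ℕ._∣ m) gcd≡p (ℕ.gcd[m,n]∣m m p)) p∤m

infix 4 _∣?_

_∣?_ : ∀ k i → Dec (k ∣ i)
k ∣? i = ∣ k ∣ ℕ.∣? ∣ i ∣

k∤i⇒k∤i-k*j : ∀ k i j → ¬ k ∣ i → ¬ k ∣ i - k * j
k∤i⇒k∤i-k*j k i j k∤i k∣i-kj =
  k∤i (∣⇒∣ᵤ {k} {i} (∣m+n∣n⇒∣m (∣ᵤ⇒∣ {k} {i - k * j} k∣i-kj) (∣m⇒∣-m (∣m⇒∣m*n j ∣-refl))))

prime∣k*i⇒prime∣i : ∀ {p k} i → Prime p → .{{_ : ℕ.NonZero k}} → k ℕ.< p → + p ∣ + k * i → + p ∣ i
prime∣k*i⇒prime∣i {p} {k} i prime-p k<p p∣ki =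
  coprime-divisor (prime⇒coprime prime-p k<p) (subst (p ℕ.∣_) (abs-* (+ k) i) p∣ki)

i*i≡+∣i∣*∣i∣ : ∀ i → i * i ≡ + (∣ i ∣ ℕ.* ∣ i ∣)
i*i≡+∣i∣*∣i∣ i = trans (cong (_◃ (∣ i ∣ ℕ.* ∣ i ∣)) (s*s≡+ (sign i))) (+◃n≡+n _)

∣sum-of-squares∣ : ∀ a b c →
  ∣ a * a + b * b + c * c ∣ ≡ ∣ a ∣ ℕ.* ∣ a ∣ ℕ.+ ∣ b ∣ ℕ.* ∣ b ∣ ℕ.+ ∣ c ∣ ℕ.* ∣ c ∣
∣sum-of-squares∣ a b c = cong ∣_∣ (begin
  a * a + b * b + c * c  ≡⟨ cong₂ _+_ (cong₂ _+_ (i*i≡+∣i∣*∣i∣ a) (i*i≡+∣i∣*∣i∣ b)) (i*i≡+∣i∣*∣i∣ c) ⟩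
  + A + + B + + C        ≡⟨ cong (_+ + C) (pos-+ A B) ⟨
  + (A ℕ.+ B) + + C      ≡⟨ pos-+ (A ℕ.+ B) C ⟨
  + (A ℕ.+ B ℕ.+ C)      ∎)
  where
  open ≡-Reasoning
  A = ∣ a ∣ ℕ.* ∣ a ∣
  B = ∣ b ∣ ℕ.* ∣ b ∣
  C = ∣ c ∣ ℕ.* ∣ c ∣

∣i∣<∣i*k∣ : ∀ {i} k → i ≢ 0ℤ → 1 ℕ.< ∣ k ∣ → ∣ i ∣ ℕ.< ∣ i * k ∣
∣i∣<∣i*k∣ {i} k i≢0 1<∣k∣ = subst (∣ i ∣ ℕ.<_) (sym (abs-* i k))
  (ℕ.m<m*n ∣ i ∣ ∣ k ∣ {{ℕ.≢-nonZero (i≢0 ∘ ∣i∣≡0⇒i≡0)}} 1<∣k∣)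

sum-of-squares-*ʳ : ∀ x y z k →
  (x * k) * (x * k) + (y * k) * (y * k) + (z * k) * (z * k) ≡ (x * x + y * y + z * z) * (k * k)
sum-of-squares-*ʳ = solve-∀

sum-of-squares-rotate : ∀ x y z → x * x + y * y + z * z ≡ y * y + z * z + x * x
sum-of-squares-rotate = solve-∀

sum-of-squares-neg : ∀ x y z → x * x + (- y) * (- y) + (- z) * (- z) ≡ x * x + y * y + z * z
sum-of-squares-neg = solve-∀

sum-of-sign-flips : ∀ x y z → (x + y + z) + (x - y - z) ≡ + 2 * x
sum-of-sign-flips = solve-∀

reflection-identity : ∀ x y z → let s = x + y + z in
    (s - + 3 * (y + z)) * (s - + 3 * (y + z))
  + (s - + 3 * (z + x)) * (s - + 3 * (z + x))
  + (s - + 3 * (x + y)) * (s - + 3 * (x + y))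
  ≡ (x * x + y * y + z * z) * + 9
reflection-identity = solve-∀

Represented : (ℤ → ℤ → ℤ → Set) → ℤ → Set
Represented P n = ∃ λ a → ∃ λ b → ∃ λ c → n ≡ a * a + b * b + c * c × P a b c

map-Represented : ∀ {P Q : ℤ → ℤ → ℤ → Set} → (∀ a b c → P a b c → Q a b c) →
                  ∀ {n} → Represented P n → Represented Q n
map-Represented f (a , b , c , n≡ , p) = a , b , c , n≡ , f a b c p

Primitive₃ : ℤ → ℤ → ℤ → Set
Primitive₃ a b c = ¬ ((+ 3 ∣ a) × (+ 3 ∣ b) × (+ 3 ∣ c))

Indivisible₃ : ℤ → ℤ → ℤ → Set
Indivisible₃ a b c = ¬ (+ 3 ∣ a) × ¬ (+ 3 ∣ b) × ¬ (+ 3 ∣ c)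

indivisible⇒primitive : ∀ a b c → Indivisible₃ a b c → Primitive₃ a b c
indivisible⇒primitive _ _ _ (3∤a , _) (3∣a , _) = 3∤a 3∣a

primitive⇒gcd≡1 : ∀ a b c → Primitive₃ a b c → gcd (gcd (gcd a b) c) (+ 3) ≡ 1ℤ
primitive⇒gcd≡1 a b c ¬3∣abc = cong +_ (prime∤⇒gcd≡1 prime[3] (¬3∣abc ∘ 3∣all))
  where
  3∣all : + 3 ∣ gcd (gcd a b) c → (+ 3 ∣ a) × (+ 3 ∣ b) × (+ 3 ∣ c)
  3∣all 3∣g = ℕ.∣-trans 3∣g (ℕ.∣-trans (gcd[i,j]∣i (gcd a b) c) (gcd[i,j]∣i a b))
            , ℕ.∣-trans 3∣g (ℕ.∣-trans (gcd[i,j]∣i (gcd a b) c) (gcd[i,j]∣j a b))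
            , ℕ.∣-trans 3∣g (gcd[i,j]∣j (gcd a b) c)

primitive⇒indivisible : ∀ {n} → + 3 ∣ n → Represented Primitive₃ n → Represented Indivisible₃ n
primitive⇒indivisible 3∣n (a , b , c , refl , ¬3∣abc)
  with square-sum-dichotomy (∣ a ∣) (∣ b ∣) (∣ c ∣) (subst (3 ℕ.∣_) (∣sum-of-squares∣ a b c) 3∣n)
... | inj₁ all-divisible = contradiction all-divisible ¬3∣abc
... | inj₂ indivisible   = a , b , c , refl , indivisible

reflection-lift : ∀ {m} x y z → m ≡ x * x + y * y + z * z → ¬ + 3 ∣ x + y + z →
                  Represented Indivisible₃ (m * + 9)
reflection-lift x y z m≡ 3∤s =
  s - + 3 * (y + z) , s - + 3 * (z + x) , s - + 3 * (x + y) ,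
  trans (cong (_* + 9) m≡) (sym (reflection-identity x y z)) ,
  k∤i⇒k∤i-k*j (+ 3) s (y + z) 3∤s ,
  k∤i⇒k∤i-k*j (+ 3) s (z + x) 3∤s ,
  k∤i⇒k∤i-k*j (+ 3) s (x + y) 3∤s
  where s = x + y + z

indivisible-lift : ∀ {m} x y z → m ≡ x * x + y * y + z * z → ¬ + 3 ∣ x →
                   Represented Indivisible₃ (m * + 9)
indivisible-lift x y z m≡ 3∤x with + 3 ∣? (x + y + z)
... | no 3∤s  = reflection-lift x y z m≡ 3∤s
... | yes 3∣s = reflection-lift x (- y) (- z) (trans m≡ (sym (sum-of-squares-neg x y z))) 3∤s′
  where
  3∤s′ : ¬ + 3 ∣ x - y - z
  3∤s′ 3∣s′ = 3∤x (prime∣k*i⇒prime∣i x prime[3] (ℕ.n<1+n 2)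
    (subst (+ 3 ∣_) (sum-of-sign-flips x y z) (∣⇒∣ᵤ 3∣s+s′)))
    where
    3∣s+s′ = ∣m∣n⇒∣m+n (∣ᵤ⇒∣ {+ 3} {x + y + z} 3∣s) (∣ᵤ⇒∣ {+ 3} {x - y - z} 3∣s′)

primitive-lift : ∀ {m} → Represented Primitive₃ m → Represented Indivisible₃ (m * + 9)
primitive-lift (x , y , z , m≡ , ¬3∣xyz) with + 3 ∣? x | + 3 ∣? y | + 3 ∣? z
... | no 3∤x | _      | _      = indivisible-lift x y z m≡ 3∤x
... | yes _  | no 3∤y | _      =
  indivisible-lift y z x (trans m≡ (sum-of-squares-rotate x y z)) 3∤y
... | yes _  | yes _  | no 3∤z =
  indivisible-lift z x y
    (trans m≡ (trans (sum-of-squares-rotate x y z) (sum-of-squares-rotate y z x))) 3∤z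
... | yes 3∣x | yes 3∣y | yes 3∣z = contradiction (3∣x , 3∣y , 3∣z) ¬3∣xyz

divide-by-3 : ∀ a b c → (+ 3 ∣ a) × (+ 3 ∣ b) × (+ 3 ∣ c) →
              ∃ λ m → SumOfThreeSquares m × a * a + b * b + c * c ≡ m * + 9
divide-by-3 a b c (3∣a , 3∣b , 3∣c)
  with ∣ᵤ⇒∣ {+ 3} {a} 3∣a | ∣ᵤ⇒∣ {+ 3} {b} 3∣b | ∣ᵤ⇒∣ {+ 3} {c} 3∣c
... | divides x refl | divides y refl | divides z refl =
  x * x + y * y + z * z , (x , y , z , refl) , sum-of-squares-*ʳ x y z (+ 3)

primitive-representation : ∀ {n} → Acc ℕ._<_ ∣ n ∣ → n ≢ 0ℤ → SumOfThreeSquares n →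
                           Represented Primitive₃ n
primitive-representation {n} (acc smaller) n≢0 (a , b , c , n≡)
  with + 3 ∣? a ×-dec + 3 ∣? b ×-dec + 3 ∣? c
... | no ¬3∣abc = a , b , c , n≡ , ¬3∣abc
... | yes 3∣abc with divide-by-3 a b c 3∣abc
...   | m , m-sum , abc≡9m = subst (Represented Primitive₃) (sym n≡9m)
          (map-Represented indivisible⇒primitive
            (primitive-lift (primitive-representation (smaller ∣m∣<∣n∣) m≢0 m-sum)))
  where
  n≡9m : n ≡ m * + 9
  n≡9m = trans n≡ abc≡9m
  m≢0 : m ≢ 0ℤ
  m≢0 m≡0 = n≢0 (trans n≡9m (cong (_* + 9) m≡0))
  ∣m∣<∣n∣ : ∣ m ∣ ℕ.< ∣ n ∣
  ∣m∣<∣n∣ = subst (λ k → ∣ m ∣ ℕ.< ∣ k ∣) (sym n≡9m) (∣i∣<∣i*k∣ (+ 9) m≢0 (ℕ.s≤s (ℕ.s≤s ℕ.z≤n)))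

proposition3p4 : (n : ℤ) → n > + 0 → SumOfThreeSquares n →
    (∃ λ a → ∃ λ b → ∃ λ c → n ≡ a * a + b * b + c * c × gcd (gcd (gcd a b) c) (+ 3) ≡ 1ℤ)
    × (+ 3 ∣ n → ∃ λ a → ∃ λ b → ∃ λ c → n ≡ a * a + b * b + c * c × ¬ (+ 3 ∣ a) × ¬ (+ 3 ∣ b) × ¬ (+ 3 ∣ c))
proposition3p4 n n>0 three-squares =
  map-Represented primitive⇒gcd≡1 representation ,
  λ 3∣n → primitive⇒indivisible 3∣n representation
  where
  representation : Represented Primitive₃ n
  representation = primitive-representation (<-wellFounded ∣ n ∣) (≢-sym (<⇒≢ n>0)) three-squares
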